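{- Let $\pi$ be a permutation of $\{1, \ldots, n\}$, let $T_1$ be the identity caterpillar on leaves $\{1,\ldots,n\}$, and let $T_2$ be the caterpillar on leaves $\{1,\ldots,n\}$ whose $i$th leaf is $\pi(i)$. If $T_1, T_2$ have a relaxed agreement forest of size $k$, then $\{1,\ldots,n\}$ can be partitioned into at most $k + 2\sqrt{2k}$ sets each of which occurs monotonically (either as an increasing or as a decreasing subsequence) in $\pi$.
   Context: An unrooted binary phylogenetic tree on a finite set $X$ is a simple connected undirected tree whose leaves are bijectively labeled by $X$ and whose non-leaf vertices all have degree $3$. For a sequence $(a_1,\ldots,a_n)$ of distinct labels, the caterpillar whose $i$th leaf is $a_i$ is obtained from the path $(y_1,\ldots,y_n)$ by attaching a leaf labeled $a_i$ to $y_i$ for each $i$ and then suppressing the resulting degree-$2$ vertices ($y_1$ and $y_n$); the identity caterpillar is the one with $a_i = i$. $T = T'$ means there is a label-preserving isomorphism. For $X' \subseteq X$, $T|X'$ is the phylogenetic tree on $X'$ obtained from the minimal subtree of $T$ connecting the leaves in $X'$ by suppressing degree-$2$ vertices. A relaxed agreement forest of $T_1, T_2$ is a partition $\{S_1,\ldots,S_k\}$ of $X$ with $T_1|S_i = T_2|S_i$ for every $i$; its size is $k$. A set $S$ occurs monotonically in $\pi$ if the elements of $S$ appear in $\pi$ (read as $\pi(1),\pi(2),\ldots,\pi(n)$) in increasing order or in decreasing order. -}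

module Defs where

open import Level using (0ℓ)
open import Data.Nat using (ℕ; zero; suc; _+_; _*_; _∸_; _≤_; _<_; _⊔_; _⊓_)
open import Data.Fin using (Fin; toℕ) renaming (_<_ to _<ᶠ_)
open import Data.Fin.Permutation using (Permutation′; _⟨$⟩ʳ_; _⟨$⟩ˡ_)
open import Data.List using (List; []; _∷_; _++_)
open import Data.List.Relation.Unary.All using (All)
open import Data.List.Relation.Unary.Unique.Propositional using (Unique)
open import Data.List.Membership.Propositional using (_∈_)
open import Data.Product using (Σ; ∃; _×_; _,_)
open import Data.Sum using (_⊎_)
open import Relation.Nullary using (¬_)
open import Relation.Binary.PropositionalEquality using (_≡_; _≢_)

record LGraph (n : ℕ) : Set₁ where
  field
    V    : Set
    Adj  : V → V → Set
    leaf : Fin n → V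

module _ {n : ℕ} (G : LGraph n) where
  open LGraph G

  data Walk : V → V → List V → Set where
    here : ∀ a → Walk a a (a ∷ [])
    step : ∀ {a c b ps} → Adj a c → Walk c b ps → Walk a b (a ∷ ps)

  Path : V → V → List V → Set
  Path a b ps = Walk a b ps × Unique ps

  -- vertex set of the minimal subtree of G connecting the leaves labelled
  -- in S : the union of all paths between two leaves with labels in S
  InSub : (Fin n → Set) → V → Set
  InSub S v = Σ (Fin n) λ x → Σ (Fin n) λ y → S x × S y ×
              Σ (List V) λ ps → Path (leaf x) (leaf y) ps × v ∈ ps

  Deg2 : (Fin n → Set) → V → Set
  Deg2 S v = Σ V λ u → Σ V λ w → u ≢ w ×
             (Adj v u × InSub S u) × (Adj v w × InSub S w) ×
             (∀ z → Adj v z → InSub S z → z ≡ u ⊎ z ≡ w)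

  -- vertices of G|S : the vertices of the minimal subtree that are not
  -- suppressed (i.e. do not have degree 2)
  Kept : (Fin n → Set) → V → Set
  Kept S v = InSub S v × ¬ Deg2 S v

  -- edges of G|S : kept vertices b, c joined by a path in the minimal
  -- subtree all of whose interior vertices are suppressed (degree 2)
  RAdj : (Fin n → Set) → V → V → Set
  RAdj S b c = Kept S b × Kept S c ×
               Σ (List V) λ mid → Path b c (b ∷ mid ++ c ∷ []) ×
                                  All (λ v → InSub S v × Deg2 S v) mid

-- G₁|S = G₂|S : a label-preserving isomorphism between the restricted trees,
-- given as a bijective relation between their vertex sets.
RestrictEq : {n : ℕ} → LGraph n → LGraph n → (Fin n → Set) → Set₁
RestrictEq G₁ G₂ S =
  Σ (LGraph.V G₁ → LGraph.V G₂ → Set) λ R →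
    (∀ {u v} → R u v → Kept G₁ S u × Kept G₂ S v) ×
    (∀ {u v v′} → R u v → R u v′ → v ≡ v′) ×
    (∀ {u u′ v} → R u v → R u′ v → u ≡ u′) ×
    (∀ u → Kept G₁ S u → Σ (LGraph.V G₂) λ v → R u v) ×
    (∀ v → Kept G₂ S v → Σ (LGraph.V G₁) λ u → R u v) ×
    (∀ x → S x → R (LGraph.leaf G₁ x) (LGraph.leaf G₂ x)) ×
    (∀ {u u′ v v′} → R u v → R u′ v′ →
       (RAdj G₁ S u u′ → RAdj G₂ S v v′) × (RAdj G₂ S v v′ → RAdj G₁ S u u′))

-- A relaxed agreement forest of size k: a partition of X into exactly k
-- (nonempty) blocks, block j = { x | f x ≡ j }, with G₁|Sⱼ = G₂|Sⱼ.
RelaxedAF : {n : ℕ} → LGraph n → LGraph n → ℕ → Set₁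
RelaxedAF {n} G₁ G₂ k =
  Σ (Fin n → Fin k) λ f →
    (∀ j → Σ (Fin n) λ x → f x ≡ j) ×
    (∀ j → RestrictEq G₁ G₂ (λ x → f x ≡ j))

-- Positions are 0-indexed: 0 … n-1.
-- After suppressing y₁ and yₙ the remaining spine vertices are at positions
-- 1 … n-2; `sp k` (k : Fin (n ∸ 2)) is the spine vertex at position k+1.
-- The leaf at position p hangs from spine position max 1 (min p (n-2)),
-- i.e. spine index (p ∸ 1) ⊓ (n ∸ 3).  For n = 2 the tree is one edge.

data CatV (n : ℕ) : Set where
  lf : Fin n → CatV n
  sp : Fin (n ∸ 2) → CatV n

data CatE (n : ℕ) : CatV n → CatV n → Set where
  leaf-spine  : (p : Fin n) (k : Fin (n ∸ 2)) →
                toℕ k ≡ (toℕ p ∸ 1) ⊓ (n ∸ 3) → CatE n (lf p) (sp k)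
  spine-spine : (k k′ : Fin (n ∸ 2)) → suc (toℕ k) ≡ toℕ k′ → CatE n (sp k) (sp k′)
  leaf-leaf   : n ≡ 2 → (p q : Fin n) → toℕ p ≡ 0 → toℕ q ≡ 1 → CatE n (lf p) (lf q)

-- the caterpillar whose i-th leaf is σ(i)
Caterpillar : (n : ℕ) → Permutation′ n → LGraph n
Caterpillar n σ = record
  { V    = CatV n
  ; Adj  = λ u v → CatE n u v ⊎ CatE n v u
  ; leaf = λ x → lf (σ ⟨$⟩ˡ x)
  }

OccursMonotonically : {n : ℕ} → Permutation′ n → (Fin n → Set) → Set
OccursMonotonically {n} π S =
  (∀ (p q : Fin n) → p <ᶠ q → S (π ⟨$⟩ʳ p) → S (π ⟨$⟩ʳ q) → (π ⟨$⟩ʳ p) <ᶠ (π ⟨$⟩ʳ q)) ⊎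
  (∀ (p q : Fin n) → p <ᶠ q → S (π ⟨$⟩ʳ p) → S (π ⟨$⟩ʳ q) → (π ⟨$⟩ʳ q) <ᶠ (π ⟨$⟩ʳ p))

-- Remove from each block S of the forest its least and greatest element. For every remaining x the
-- spine vertex carrying x survives in T₁|S and the agreement matches it with a spine vertex of T₂|S;
-- consecutive remaining elements give adjacent vertices of T₁|S, hence adjacent vertices of T₂|S,
-- between which no kept spine vertex lies. So the matched spine indices are monotone in x, and as the
-- leaves of T₂|S attach to spine vertices in the order of their positions, the rest of S occurs
-- monotonically. The 2k removed elements are split into c monotone classes with c² ≤ 4 · 2k: while a
-- longest decreasing subsequence of the ℓ elements left has length d > 2√ℓ it becomes one class, and
-- otherwise the elements are coloured by the length of the longest decreasing subsequence ending at
-- them, each colour class being increasing.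
module Submission where

open import Defs
open import Level using (0ℓ)
open import Data.Empty using (⊥; ⊥-elim)
open import Data.Nat
open import Data.Nat.Properties
open import Data.Nat.Induction using (<-wellFounded)
open import Data.Fin using (Fin; toℕ; fromℕ<; zero; suc; splitAt; join) renaming (_≟_ to _≟ᶠ_)
open import Data.Fin.Properties using (toℕ-injective; toℕ-fromℕ<; toℕ<n; any?; splitAt-join)
  renaming (suc-injective to suc-injectiveᶠ)
open import Data.Fin.Permutation using (Permutation′; _⟨$⟩ʳ_; _⟨$⟩ˡ_; id; inverseˡ; inverseʳ)
open import Data.List using (List; []; _∷_; _++_; _∷ʳ_; length; filter; tabulate)
open import Data.List.Properties using (filter-notAll; length-++; length-tabulate)
open import Data.List.Relation.Unary.All as All using (All; []; _∷_)
open import Data.List.Relation.Unary.All.Properties using (∷ʳ⁺)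
open import Data.List.Relation.Unary.AllPairs as AllPairs using (AllPairs; []; _∷_)
open import Data.List.Relation.Unary.Any as Any using (here; there)
open import Data.List.Relation.Unary.Unique.Propositional using (Unique)
open import Data.List.Membership.Propositional using (_∈_; _∉_)
open import Data.List.Membership.Propositional.Properties using (∈-++⁻; ∈-++⁺ˡ; ∈-++⁺ʳ; ∈-filter⁺; ∈-tabulate⁺)
import Data.List.Membership.DecPropositional as DecMembership
open import Data.Product
open import Data.Sum using (_⊎_; inj₁; inj₂)
import Data.Sum as Sum
open import Data.Sum.Properties using (inj₁-injective; inj₂-injective)
open import Function using (_∘_; flip)
import Induction.WellFounded as WF
import Relation.Binary.Construct.On as On
open import Relation.Binary.Definitions using (Tri; tri<; tri≈; tri>)
open import Relation.Binary.PropositionalEquality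
open import Relation.Nullary
open import Relation.Unary using (Decidable)

-- Gap-free labellings

least : ∀ {M} (P : Fin M → Set) → Decidable P →
        (∃ λ x → P x × ∀ y → P y → toℕ x ≤ toℕ y) ⊎ (∀ x → ¬ P x)
least {zero}  P P? = inj₂ λ ()
least {suc M} P P? with P? zero
... | yes p₀ = inj₁ (zero , p₀ , λ _ _ → z≤n)
... | no ¬p₀ with least (λ x → P (suc x)) (λ x → P? (suc x))
...   | inj₁ (x , px , x-least) = inj₁ (suc x , px , λ { zero p₀ → ⊥-elim (¬p₀ p₀) ; (suc y) py → s≤s (x-least y py) })
...   | inj₂ none              = inj₂ λ { zero → ¬p₀ ; (suc x) → none x }

greatest : ∀ {M} (P : Fin M → Set) → Decidable P →
           (∃ λ x → P x × ∀ y → P y → toℕ y ≤ toℕ x) ⊎ (∀ x → ¬ P x)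
greatest {zero}  P P? = inj₂ λ ()
greatest {suc M} P P? with greatest (λ x → P (suc x)) (λ x → P? (suc x))
... | inj₁ (x , px , x-greatest) = inj₁ (suc x , px , λ { zero _ → z≤n ; (suc y) py → s≤s (x-greatest y py) })
... | inj₂ none with P? zero
...   | yes p₀ = inj₁ (zero , p₀ , λ { zero _ → z≤n ; (suc y) py → ⊥-elim (none y py) })
...   | no ¬p₀ = inj₂ λ { zero → ¬p₀ ; (suc x) → none x }

StrictlyBetween : ℕ → ℕ → ℕ → Set
StrictlyBetween a b c = (a < b × b < c) ⊎ (c < b × b < a)

Between : ℕ → ℕ → ℕ → Set
Between a e b = (a ≤ e × e ≤ b) ⊎ (b ≤ e × e ≤ a)

strict⇒Between : ∀ {a e b} → StrictlyBetween a e b → Between a e b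
strict⇒Between (inj₁ (a<e , e<b)) = inj₁ (<⇒≤ a<e , <⇒≤ e<b)
strict⇒Between (inj₂ (b<e , e<a)) = inj₂ (<⇒≤ b<e , <⇒≤ e<a)

StrictlyBetween-≢ˡ : ∀ {a e b} → StrictlyBetween a e b → e ≢ a
StrictlyBetween-≢ˡ (inj₁ (a<e , _)) = >⇒≢ a<e
StrictlyBetween-≢ˡ (inj₂ (_ , e<a)) = <⇒≢ e<a

StrictlyBetween-≢ʳ : ∀ {a e b} → StrictlyBetween a e b → e ≢ b
StrictlyBetween-≢ʳ (inj₁ (_ , e<b)) = <⇒≢ e<b
StrictlyBetween-≢ʳ (inj₂ (b<e , _)) = >⇒≢ b<e

module GapFree {M : ℕ} (D : Fin M → Set) (D? : Decidable D) (val : ∀ x → D x → ℕ)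
  (val-irrelevant : ∀ x dx dx′ → val x dx ≡ val x dx′)
  (val-injective : ∀ x y dx dy → val x dx ≡ val y dy → x ≡ y) where

  Consecutive : Fin M → Fin M → Set
  Consecutive x y = toℕ x < toℕ y × (∀ p → D p → toℕ x < toℕ p → toℕ p < toℕ y → ⊥)

  GapFreeLabels : Set
  GapFreeLabels = ∀ x y w dx dy dw → Consecutive x y → ¬ StrictlyBetween (val x dx) (val w dw) (val y dy)

  private
    val-cong : ∀ {x x′} (x≡x′ : x ≡ x′) dx dx′ → val x dx ≡ val x′ dx′
    val-cong refl dx dx′ = val-irrelevant _ dx dx′

    ≢-< : ∀ {x y : Fin M} → toℕ x < toℕ y → x ≢ y
    ≢-< lt refl = <-irrefl refl lt

    <-connex : ∀ {a b} → a ≢ b → a < b ⊎ b < a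
    <-connex {a} {b} a≢b with <-cmp a b
    ... | tri< a<b _ _ = inj₁ a<b
    ... | tri≈ _ a≡b _ = ⊥-elim (a≢b a≡b)
    ... | tri> _ _ b<a = inj₂ b<a

    StrictlyBetween-flip : ∀ {a b c} → (b < a × c < b) ⊎ (b < c × a < b) → StrictlyBetween a b c
    StrictlyBetween-flip (inj₁ (b<a , c<b)) = inj₂ (c<b , b<a)
    StrictlyBetween-flip (inj₂ (b<c , a<b)) = inj₁ (a<b , b<c)

  -- _≺_ is _<_ or _>_; x₀ and x₁ are the two least elements of D.
  module Oriented (_≺_ : ℕ → ℕ → Set) (≺-trans : ∀ {a b c} → a ≺ b → b ≺ c → a ≺ c)
    (≺-connex : ∀ {a b} → a ≢ b → a ≺ b ⊎ b ≺ a)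
    (gap-free : ∀ x y w dx dy dw → Consecutive x y →
       (val x dx ≺ val w dw × val w dw ≺ val y dy) ⊎ (val y dy ≺ val w dw × val w dw ≺ val x dx) → ⊥)
    (x₀ : Fin M) (d₀ : D x₀) (x₀-least : ∀ y → D y → toℕ x₀ ≤ toℕ y)
    (x₁ : Fin M) (d₁ : D x₁) (x₀x₁ : Consecutive x₀ x₁) (x₀≺x₁ : val x₀ d₀ ≺ val x₁ d₁) where

    previous : ∀ y → D y → toℕ x₀ < toℕ y → ∃ λ p → D p × Consecutive p y
    previous y dy x₀<y with greatest (λ p → D p × toℕ p < toℕ y) (λ p → D? p ×-dec (toℕ p <? toℕ y))
    ... | inj₂ none = ⊥-elim (none x₀ (d₀ , x₀<y))
    ... | inj₁ (p , (dp , p<y) , p-greatest) = p , dp , p<y , λ q dq p<q q<y → <⇒≱ p<q (p-greatest q (dq , q<y))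

    orientation-persists : ∀ a b c da db dc → Consecutive a b → Consecutive b c →
                           val a da ≺ val b db → val b db ≺ val c dc
    orientation-persists a b c da db dc ab bc a≺b
      with ≺-connex {val b db} {val c dc} (≢-< (proj₁ bc) ∘ val-injective _ _ _ _)
    ... | inj₁ b≺c = b≺c
    ... | inj₂ c≺b with ≺-connex {val c dc} {val a da} (≢-< (<-trans (proj₁ ab) (proj₁ bc)) ∘ sym ∘ val-injective _ _ _ _)
    ...   | inj₁ c≺a = ⊥-elim (gap-free b c a db dc da bc (inj₂ (c≺a , a≺b)))
    ...   | inj₂ a≺c = ⊥-elim (gap-free a b c da db dc ab (inj₁ (a≺c , c≺b)))

    consecutive-unique : ∀ {x y y′} → D y → D y′ → Consecutive x y → Consecutive x y′ → y ≡ y′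
    consecutive-unique dy dy′ (x<y , gap) (x<y′ , gap′) =
      toℕ-injective (≤-antisym (≮⇒≥ (gap _ dy′ x<y′)) (≮⇒≥ (gap′ _ dy x<y)))

    first-pair : ∀ x y dx dy → Consecutive x₀ y → toℕ x < toℕ y → val x dx ≺ val y dy
    first-pair x y dx dy x₀y x<y = subst₂ _≺_ (val-cong x₀≡x d₀ dx) (val-cong x₁≡y d₁ dy) x₀≺x₁
      where
      x₁≡y : x₁ ≡ y
      x₁≡y = consecutive-unique d₁ dy x₀x₁ x₀y
      x₀≡x : x₀ ≡ x
      x₀≡x = toℕ-injective (≤-antisym (x₀-least x dx) (≮⇒≥ λ x₀<x → proj₂ x₀y x dx x₀<x x<y))

    oriented-before : ∀ fuel y dy → toℕ y < fuel → toℕ x₀ < toℕ y →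
                      ∀ x dx → toℕ x < toℕ y → val x dx ≺ val y dy
    previous-before : ∀ fuel y dy p dp → toℕ y < suc fuel → Consecutive p y → toℕ x₀ < toℕ p →
                      val p dp ≺ val y dy

    oriented-before (suc fuel) y dy y<fuel x₀<y x dx x<y with previous y dy x₀<y
    ... | p , dp , py with toℕ p ≟ toℕ x₀
    ...   | yes p≡x₀ = first-pair x y dx dy (subst (λ p → Consecutive p y) (toℕ-injective p≡x₀) py) x<y
    ...   | no  p≢x₀ with toℕ x ≟ toℕ p
    ...     | yes x≡p = subst (_≺ val y dy) (val-cong (toℕ-injective (sym x≡p)) dp dx)
                          (previous-before fuel y dy p dp y<fuel py (≤∧≢⇒< (x₀-least p dp) (p≢x₀ ∘ sym)))
    ...     | no  x≢p = ≺-trans (oriented-before fuel p dp p<fuel x₀<p x dx x<p)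
                                (previous-before fuel y dy p dp y<fuel py x₀<p)
      where
      x₀<p : toℕ x₀ < toℕ p
      x₀<p = ≤∧≢⇒< (x₀-least p dp) (p≢x₀ ∘ sym)
      p<fuel : toℕ p < fuel
      p<fuel = ≤-trans (proj₁ py) (≤-pred y<fuel)
      x<p : toℕ x < toℕ p
      x<p = ≤∧≢⇒< (≮⇒≥ λ p<x → proj₂ py x dx p<x x<y) x≢p

    previous-before fuel y dy p dp y<fuel py x₀<p with previous p dp x₀<p
    ... | o , d-o , op = orientation-persists o p y d-o dp dy op py
                           (oriented-before fuel p dp (≤-trans (proj₁ py) (≤-pred y<fuel)) x₀<p o d-o (proj₁ op))

    oriented : ∀ x y dx dy → toℕ x < toℕ y → val x dx ≺ val y dy
    oriented x y dx dy x<y = oriented-before (suc (toℕ y)) y dy ≤-refl (≤-<-trans (x₀-least x dx) x<y) x dx x<y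

  LabelsIncrease LabelsDecrease : Set
  LabelsIncrease = ∀ x y dx dy → toℕ x < toℕ y → val x dx < val y dy
  LabelsDecrease = ∀ x y dx dy → toℕ x < toℕ y → val y dy < val x dx

  monotone : GapFreeLabels → LabelsIncrease ⊎ LabelsDecrease
  monotone gap-free with least D D?
  ... | inj₂ empty = inj₁ λ x _ dx _ _ → ⊥-elim (empty x dx)
  ... | inj₁ (x₀ , d₀ , x₀-least)
    with least (λ x → D x × toℕ x₀ < toℕ x) (λ x → D? x ×-dec (toℕ x₀ <? toℕ x))
  ...   | inj₂ singleton = inj₁ λ x y dx dy x<y → ⊥-elim (singleton y (dy , ≤-<-trans (x₀-least x dx) x<y))
  ...   | inj₁ (x₁ , (d₁ , x₀<x₁) , x₁-least) = orient (<-cmp (val x₀ d₀) (val x₁ d₁))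
    where
    x₀x₁ : Consecutive x₀ x₁
    x₀x₁ = x₀<x₁ , λ q dq x₀<q q<x₁ → <⇒≱ q<x₁ (x₁-least q (dq , x₀<q))
    orient : Tri (val x₀ d₀ < val x₁ d₁) (val x₀ d₀ ≡ val x₁ d₁) (val x₁ d₁ < val x₀ d₀) →
             LabelsIncrease ⊎ LabelsDecrease
    orient (tri< up _ _)   = inj₁ (Oriented.oriented _<_ <-trans <-connex gap-free x₀ d₀ x₀-least x₁ d₁ x₀x₁ up)
    orient (tri≈ _ same _) = ⊥-elim (≢-< x₀<x₁ (val-injective _ _ _ _ same))
    orient (tri> _ _ down) = inj₂ (Oriented.oriented _>_ (flip <-trans) (<-connex ∘ (_∘ sym))
                               (λ x y w dx dy dw xy → gap-free x y w dx dy dw xy ∘ StrictlyBetween-flip)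
                               x₀ d₀ x₀-least x₁ d₁ x₀x₁ down)

minimum : ∀ {M} {P : Fin M → Set} → Decidable P → ∃ P → ∃ λ x → P x × ∀ y → P y → toℕ x ≤ toℕ y
minimum P? (x , px) with least _ P?
... | inj₁ found = found
... | inj₂ none  = ⊥-elim (none x px)

maximum : ∀ {M} {P : Fin M → Set} → Decidable P → ∃ P → ∃ λ x → P x × ∀ y → P y → toℕ y ≤ toℕ x
maximum P? (x , px) with greatest _ P?
... | inj₁ found = found
... | inj₂ none  = ⊥-elim (none x px)

-- Partitioning a sequence into monotone subsequences

maxBelow : ℕ → (ℕ → ℕ) → ℕ
maxBelow zero    f = 0
maxBelow (suc p) f = maxBelow p f ⊔ f p

maxBelow-upper : ∀ {p} f {q} → q < p → f q ≤ maxBelow p f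
maxBelow-upper {suc p} f {q} q<1+p with m<1+n⇒m<n∨m≡n q<1+p
... | inj₁ q<p  = ≤-trans (maxBelow-upper f q<p) (m≤m⊔n _ _)
... | inj₂ refl = m≤n⊔m _ _

maxBelow-attained : ∀ p f → maxBelow p f ≡ 0 ⊎ ∃ λ q → q < p × f q ≡ maxBelow p f
maxBelow-attained zero    f = inj₁ refl
maxBelow-attained (suc p) f with ⊔-sel (maxBelow p f) (f p)
... | inj₂ eq = inj₂ (p , ≤-refl , sym eq)
... | inj₁ eq with maxBelow-attained p f
...   | inj₁ zero-max         = inj₁ (trans eq zero-max)
...   | inj₂ (q , q<p , f-q) = inj₂ (q , m<n⇒m<1+n q<p , trans f-q (sym eq))

maxBelow-cong : ∀ p {f g} → (∀ {q} → q < p → f q ≡ g q) → maxBelow p f ≡ maxBelow p g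
maxBelow-cong zero    f≗g = refl
maxBelow-cong (suc p) f≗g = cong₂ _⊔_ (maxBelow-cong p (f≗g ∘ m<n⇒m<1+n)) (f≗g ≤-refl)

onlyIf : ∀ {A : Set} → Dec A → ℕ → ℕ
onlyIf (yes _) l = l
onlyIf (no _)  l = 0

onlyIf-yes : ∀ {A : Set} (a? : Dec A) → A → ∀ l → onlyIf a? l ≡ l
onlyIf-yes (yes _) a  l = refl
onlyIf-yes (no ¬a) a  l = ⊥-elim (¬a a)

-- c < d because c² ≤ 4 l ≤ 4 N < d²
square-bound-step : ∀ c l d N → c * c ≤ 4 * l → l + d ≤ N → 4 * N < d * d →
                    suc c * suc c ≤ 4 * N
square-bound-step c l d N c²≤4l l+d≤N 4N<d² = begin
    suc c * suc c             ≡⟨ cong (suc c +_) (*-suc c c) ⟩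
    suc c + (c + c * c)       ≤⟨ +-mono-≤ c<d (+-mono-≤ (<⇒≤ c<d) c²≤4l) ⟩
    d + (d + 4 * l)           ≡⟨ trans (sym (+-assoc d d (4 * l))) (+-comm (d + d) (4 * l)) ⟩
    4 * l + (d + d)           ≤⟨ +-monoʳ-≤ (4 * l) (+-monoʳ-≤ d (m≤m+n d (2 * d))) ⟩
    4 * l + 4 * d             ≡⟨ sym (*-distribˡ-+ 4 l d) ⟩
    4 * (l + d)               ≤⟨ *-monoʳ-≤ 4 l+d≤N ⟩
    4 * N                     ∎
  where
  open ≤-Reasoning
  c<d : c < d
  c<d = *-cancel-<-self (≤-<-trans c²≤4l (≤-<-trans (*-monoʳ-≤ 4 (≤-trans (m≤m+n l d) l+d≤N)) 4N<d²))
    where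
    *-cancel-<-self : ∀ {a b} → a * a < b * b → a < b
    *-cancel-<-self {a} {b} lt with a <? b
    ... | yes a<b = a<b
    ... | no  a≮b = ⊥-elim (<⇒≱ lt (*-mono-≤ (≮⇒≥ a≮b) (≮⇒≥ a≮b)))

position : ∀ {n} → Permutation′ n → Fin n → ℕ
position π x = toℕ (π ⟨$⟩ˡ x)

Increasing Decreasing Monotone : ∀ {n} → Permutation′ n → (Fin n → Set) → Set
Increasing π P = ∀ x y → P x → P y → position π x < position π y → toℕ x < toℕ y
Decreasing π P = ∀ x y → P x → P y → position π x < position π y → toℕ y < toℕ x
Monotone π P = Increasing π P ⊎ Decreasing π P

Monotone-⊆ : ∀ {n} {π : Permutation′ n} {P Q : Fin n → Set} → (∀ x → P x → Q x) → Monotone π Q → Monotone π P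
Monotone-⊆ P⊆Q (inj₁ inc) = inj₁ λ x y px py → inc x y (P⊆Q x px) (P⊆Q y py)
Monotone-⊆ P⊆Q (inj₂ dec) = inj₂ λ x y px py → dec x y (P⊆Q x px) (P⊆Q y py)

Class : ∀ {n c} (L : List (Fin n)) → (∀ x → x ∈ L → Fin c) → Fin c → Fin n → Set
Class L colour i x = Σ (x ∈ L) λ x∈L → colour x x∈L ≡ i

module MonotonePartition {n₀ : ℕ} (π : Permutation′ (suc n₀)) where

  private
    n = suc n₀

  open DecMembership (_≟ᶠ_ {n}) using (_∈?_) public

  -- the label at a position; positions beyond the last one are clamped to it
  label : ℕ → Fin n
  label q = π ⟨$⟩ʳ fromℕ< {q ⊓ n₀} (s≤s (m⊓n≤n q n₀))

  label-position : ∀ x → label (position π x) ≡ x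
  label-position x = trans (cong (π ⟨$⟩ʳ_) (toℕ-injective clamp-id)) (inverseʳ π)
    where
    clamp-id : toℕ (fromℕ< {position π x ⊓ n₀} _) ≡ position π x
    clamp-id = trans (toℕ-fromℕ< _) (m≤n⇒m⊓n≡m (≤-pred (toℕ<n (π ⟨$⟩ˡ x))))

  position-label : ∀ {q} → q < n → position π (label q) ≡ q
  position-label q<n = trans (cong toℕ (inverseˡ π)) (trans (toℕ-fromℕ< _) (m≤n⇒m⊓n≡m (≤-pred q<n)))

  module Chains (L : List (Fin n)) where

    Descends : ℕ → ℕ → Set
    Descends q′ q = q′ < q × label q′ ∈ L × toℕ (label q) < toℕ (label q′)

    descends? : ∀ q′ q → Dec (Descends q′ q)
    descends? q′ q = (q′ <? q) ×-dec ((label q′ ∈? L) ×-dec (toℕ (label q) <? toℕ (label q′)))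

    longestBefore : ℕ → (ℕ → ℕ) → ℕ
    longestBefore q ℓ = maxBelow q (λ q′ → onlyIf (descends? q′ q) (ℓ q′))

    -- chainLength q is the length of a longest subsequence of L, decreasing along positions, ending at
    -- position q; chainLengthsBelow p tabulates it for q < p, making the course-of-values recursion structural.
    chainLengthsBelow : ℕ → ℕ → ℕ
    chainLengthsBelow zero    q = 0
    chainLengthsBelow (suc p) q with q ≟ p
    ... | yes _ = suc (longestBefore p (chainLengthsBelow p))
    ... | no  _ = chainLengthsBelow p q

    chainLength : ℕ → ℕ
    chainLength q = chainLengthsBelow (suc q) q

    chainLength-def : ∀ q → chainLength q ≡ suc (longestBefore q (chainLengthsBelow q))
    chainLength-def q with q ≟ q
    ... | yes _   = refl
    ... | no  q≢q = ⊥-elim (q≢q refl)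

    chainLengthsBelow-stable : ∀ {p q} → q < p → chainLengthsBelow p q ≡ chainLength q
    chainLengthsBelow-stable {suc p} {q} q<1+p with q ≟ p
    ... | yes refl = sym (chainLength-def q)
    ... | no  q≢p  = chainLengthsBelow-stable (≤∧≢⇒< (≤-pred q<1+p) q≢p)

    chainLength-unfold : ∀ q → chainLength q ≡ suc (longestBefore q chainLength)
    chainLength-unfold q = trans (chainLength-def q) (cong suc (maxBelow-cong q λ q′<q →
                             cong (onlyIf (descends? _ q)) (chainLengthsBelow-stable q′<q)))

    chainLength-descends : ∀ {q′ q} → Descends q′ q → chainLength q′ < chainLength q
    chainLength-descends {q′} {q} d = subst (chainLength q′ <_) (sym (chainLength-unfold q))
      (s≤s (subst (_≤ longestBefore q chainLength) (onlyIf-yes (descends? q′ q) d (chainLength q′))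
        (maxBelow-upper (λ q″ → onlyIf (descends? q″ q) (chainLength q″)) (proj₁ d))))

    chainLength-predecessor : ∀ q {d} → chainLength q ≡ suc (suc d) →
                              ∃ λ q′ → Descends q′ q × chainLength q′ ≡ suc d
    chainLength-predecessor q {d} eq
      with maxBelow-attained q (λ q′ → onlyIf (descends? q′ q) (chainLength q′))
    ... | inj₁ zero-max = ⊥-elim (1+n≢0 (suc-injective (trans (sym eq) (trans (chainLength-unfold q) (cong suc zero-max)))))
    ... | inj₂ (q′ , _ , attained) with descends? q′ q
    ...   | yes d′ = q′ , d′ , trans attained (suc-injective (trans (sym (chainLength-unfold q)) eq))
    ...   | no  _  = ⊥-elim (1+n≢0 (trans (suc-injective (trans (sym eq) (chainLength-unfold q))) (sym attained)))

    -- chains are listed from their last position backwards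
    Precedes : Fin n → Fin n → Set
    Precedes x y = position π y < position π x × toℕ x < toℕ y

    DecreasingChain : List (Fin n) → Set
    DecreasingChain = AllPairs Precedes

    Precedes-trans : ∀ {x y z} → Precedes x y → Precedes y z → Precedes x z
    Precedes-trans (yx , xy) (zy , yz) = <-trans zy yx , <-trans xy yz

    decreasingChain : ∀ d q → q < n → chainLength q ≡ suc d → label q ∈ L →
                      ∃ λ r → length r ≡ d × All (_∈ L) (label q ∷ r) × DecreasingChain (label q ∷ r)
    decreasingChain zero    q q<n eq q∈L = [] , refl , q∈L ∷ [] , [] ∷ []
    decreasingChain (suc d) q q<n eq q∈L with chainLength-predecessor q eq
    ... | q′ , (q′<q , q′∈L , label<) , eq′ with decreasingChain d q′ (<-trans q′<q q<n) eq′ q′∈L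
    ...   | r , len , all∈L , dec =
      label q′ ∷ r , cong suc len , q∈L ∷ all∈L , (q-q′ ∷ All.map (Precedes-trans q-q′) (AllPairs.head dec)) ∷ dec
      where
      q-q′ : Precedes (label q) (label q′)
      q-q′ = subst₂ _<_ (sym (position-label (<-trans q′<q q<n))) (sym (position-label q<n)) q′<q , label<

    DecreasingChain-decreasing : ∀ {chain} → DecreasingChain chain → Decreasing π (_∈ chain)
    DecreasingChain-decreasing (x-first ∷ _) x y (here refl) (here refl) lt = ⊥-elim (<-irrefl refl lt)
    DecreasingChain-decreasing (x-first ∷ _) x y (here refl) (there y∈) lt = ⊥-elim (<-asym lt (proj₁ (All.lookup x-first y∈)))
    DecreasingChain-decreasing (x-first ∷ _) x y (there x∈) (here refl) lt = proj₂ (All.lookup x-first x∈)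
    DecreasingChain-decreasing (_ ∷ dec) x y (there x∈) (there y∈) lt = DecreasingChain-decreasing dec x y x∈ y∈ lt

    DecreasingChain-unique : ∀ {chain} → DecreasingChain chain → Unique chain
    DecreasingChain-unique = AllPairs.map λ { (_ , x<y) refl → <-irrefl refl x<y }

  removeAll : List (Fin n) → List (Fin n) → List (Fin n)
  removeAll []      L = L
  removeAll (a ∷ r) L = removeAll r (filter (λ x → ¬? (x ≟ᶠ a)) L)

  ∈-removeAll : ∀ r L {x} → x ∈ L → x ∉ r → x ∈ removeAll r L
  ∈-removeAll []      L x∈L x∉r = x∈L
  ∈-removeAll (a ∷ r) L x∈L x∉r =
    ∈-removeAll r _ (∈-filter⁺ (λ x → ¬? (x ≟ᶠ a)) x∈L (x∉r ∘ here)) (x∉r ∘ there)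

  length-removeAll : ∀ r L → Unique r → All (_∈ L) r → length (removeAll r L) + length r ≤ length L
  length-removeAll []      L _ _ = ≤-reflexive (+-identityʳ _)
  length-removeAll (a ∷ r) L (a∉r ∷ r-unique) (a∈L ∷ r⊆L) = begin
      length (removeAll r L′) + suc (length r)  ≡⟨ +-suc _ _ ⟩
      suc (length (removeAll r L′) + length r)  ≤⟨ s≤s (length-removeAll r L′ r-unique r⊆L′) ⟩
      suc (length L′)                            ≤⟨ filter-notAll (λ x → ¬? (x ≟ᶠ a)) L a-removed ⟩
      length L                                   ∎
    where
    open ≤-Reasoning
    L′ : List (Fin n)
    L′ = filter (λ x → ¬? (x ≟ᶠ a)) L
    r⊆L′ : All (_∈ L′) r
    r⊆L′ = All.tabulate λ b∈r → ∈-filter⁺ (λ x → ¬? (x ≟ᶠ a)) (All.lookup r⊆L b∈r) (All.lookup a∉r b∈r ∘ sym)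
    a-removed : Any.Any (λ x → ¬ ¬ x ≡ a) L
    a-removed = Any.map (λ { refl x≢a → x≢a refl }) a∈L

  length-removeAll-< : ∀ a r L → Unique (a ∷ r) → All (_∈ L) (a ∷ r) → length (removeAll (a ∷ r) L) < length L
  length-removeAll-< a r L unique ⊆L =
    ≤-trans (s≤s (m≤m+n _ _)) (≤-trans (≤-reflexive (sym (+-suc _ _))) (length-removeAll (a ∷ r) L unique ⊆L))

  MonotoneColouring : List (Fin n) → Set
  MonotoneColouring L = Σ ℕ λ c → c * c ≤ 4 * length L ×
                          Σ (∀ x → x ∈ L → Fin c) λ colour → ∀ i → Monotone π (Class L colour i)

  extendColouring : ∀ {L} chain {c} (colour : ∀ x → x ∈ removeAll chain L → Fin c) →
                    Decreasing π (_∈ chain) → (∀ i → Monotone π (Class (removeAll chain L) colour i)) →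
                    Σ (∀ x → x ∈ L → Fin (suc c)) λ colour′ → ∀ i → Monotone π (Class L colour′ i)
  extendColouring {L} chain colour chain-dec monotone = colour′ , monotone′
    where
    colour′ : ∀ x → x ∈ L → Fin _
    colour′ x x∈L with x ∈? chain
    ... | yes _   = zero
    ... | no  x∉c = suc (colour x (∈-removeAll chain L x∈L x∉c))
    class-zero : ∀ x → Class L colour′ zero x → x ∈ chain
    class-zero x (x∈L , cx) with x ∈? chain
    ... | yes x∈c = x∈c
    class-zero x (x∈L , ()) | no _
    class-suc : ∀ i x → Class L colour′ (suc i) x → Class (removeAll chain L) colour i x
    class-suc i x (x∈L , cx) with x ∈? chain
    class-suc i x (x∈L , ()) | yes _
    ... | no x∉c = ∈-removeAll chain L x∈L x∉c , suc-injectiveᶠ cx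
    monotone′ : ∀ i → Monotone π (Class L colour′ i)
    monotone′ zero    = Monotone-⊆ {π = π} class-zero (inj₂ chain-dec)
    monotone′ (suc i) = Monotone-⊆ {π = π} (class-suc i) (monotone i)

  module _ (L : List (Fin n)) where
    open Chains L

    longestChain : ℕ
    longestChain = maxBelow n (λ q → onlyIf (label q ∈? L) (chainLength q))

    level : Fin n → ℕ
    level x = chainLength (position π x)

    label-position∈L : ∀ {x} → x ∈ L → label (position π x) ∈ L
    label-position∈L {x} = subst (_∈ L) (sym (label-position x))

    level≤longestChain : ∀ {x} → x ∈ L → level x ≤ longestChain
    level≤longestChain {x} x∈L =
      subst (_≤ longestChain) (onlyIf-yes (label (position π x) ∈? L) (label-position∈L x∈L) (level x))
            (maxBelow-upper (λ q → onlyIf (label q ∈? L) (chainLength q)) (toℕ<n (π ⟨$⟩ˡ x)))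

    level-positive : ∀ x → suc (pred (level x)) ≡ level x
    level-positive x = trans (cong (λ l → suc (pred l)) (chainLength-unfold (position π x))) (sym (chainLength-unfold (position π x)))

    sameLevel-increasing : ∀ {x y} → x ∈ L → level x ≡ level y → position π x < position π y → toℕ x < toℕ y
    sameLevel-increasing {x} {y} x∈L same before with <-cmp (toℕ x) (toℕ y)
    ... | tri< x<y _ _ = x<y
    ... | tri≈ _ x≡y _ = ⊥-elim (<-irrefl (cong (position π) (toℕ-injective x≡y)) before)
    ... | tri> _ _ y<x = ⊥-elim (<-irrefl same (chainLength-descends (before , label-position∈L x∈L ,
                           subst₂ (λ a b → toℕ a < toℕ b) (sym (label-position y)) (sym (label-position x)) y<x)))

    colourByLevel : longestChain * longestChain ≤ 4 * length L → MonotoneColouring L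
    colourByLevel bound = longestChain , bound , colour , λ i → inj₁ λ x y (x∈L , cx) (y∈L , cy) →
                            sameLevel-increasing x∈L (colour-level x y {x∈L} {y∈L} (trans cx (sym cy)))
      where
      colour : ∀ x → x ∈ L → Fin longestChain
      colour x x∈L = fromℕ< {pred (level x)} (subst (_≤ longestChain) (sym (level-positive x)) (level≤longestChain x∈L))
      colour-level : ∀ x y {x∈L y∈L} → colour x x∈L ≡ colour y y∈L → level x ≡ level y
      colour-level x y eq = begin
        level x               ≡⟨ sym (level-positive x) ⟩
        suc (pred (level x))  ≡⟨ cong suc (trans (sym (toℕ-fromℕ< _)) (trans (cong toℕ eq) (toℕ-fromℕ< _))) ⟩
        suc (pred (level y))  ≡⟨ level-positive y ⟩
        level y               ∎
        where open ≡-Reasoning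

    peelLongestChain : 4 * length L < longestChain * longestChain →
                       (∀ {L′} → length L′ < length L → MonotoneColouring L′) → MonotoneColouring L
    peelLongestChain long recurse
      with maxBelow-attained n (λ q → onlyIf (label q ∈? L) (chainLength q))
    ... | inj₁ zero-max = ⊥-elim (<⇒≱ long (subst (λ t → t * t ≤ 4 * length L) (sym zero-max) z≤n))
    ... | inj₂ (q , q<n , attained) with label q ∈? L
    ...   | no  _   = ⊥-elim (<⇒≱ long (subst (λ t → t * t ≤ 4 * length L) attained z≤n))
    ...   | yes q∈L with decreasingChain _ q q<n (chainLength-unfold q) q∈L
    ...     | r , length-r , chain⊆L , chain-dec
      with recurse (length-removeAll-< (label q) r L (DecreasingChain-unique chain-dec) chain⊆L)
    ...       | c , c²≤ , colour , monotone = suc c , bound , extendColouring (label q ∷ r) colour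
                                                (DecreasingChain-decreasing chain-dec) monotone
      where
      bound : suc c * suc c ≤ 4 * length L
      bound = square-bound-step c _ (suc (length r)) (length L) c²≤
                (length-removeAll (label q ∷ r) L (DecreasingChain-unique chain-dec) chain⊆L)
                (subst (λ t → 4 * length L < t * t)
                       (sym (trans (cong suc length-r) (trans (sym (chainLength-unfold q)) attained))) long)

  monotoneColouring : ∀ L → MonotoneColouring L
  monotoneColouring = WF.All.wfRec (On.wellFounded length <-wellFounded) 0ℓ MonotoneColouring colour-or-peel
    where
    colour-or-peel : ∀ L → (∀ {L′} → length L′ < length L → MonotoneColouring L′) → MonotoneColouring L
    colour-or-peel L recurse with longestChain L * longestChain L ≤? 4 * length L
    ... | yes short = colourByLevel L short
    ... | no  long  = peelLongestChain L (≰⇒> long) recurse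

-- Paths in caterpillars

module _ {A : Set} where

  Unique-∷ʳ : ∀ {xs : List A} {x} → Unique xs → All (_≢ x) xs → Unique (xs ∷ʳ x)
  Unique-∷ʳ []                 []              = [] ∷ []
  Unique-∷ʳ (y∉ys ∷ ys-unique) (y≢x ∷ ys≢x) = ∷ʳ⁺ y∉ys y≢x ∷ Unique-∷ʳ ys-unique ys≢x

  Unique-∷ʳ-≢ : ∀ {xs : List A} {x y} → Unique (xs ∷ʳ x) → y ∈ xs → y ≢ x
  Unique-∷ʳ-≢ {_ ∷ xs} (y∉ ∷ _) (here refl) = All.lookup y∉ (∈-++⁺ʳ xs (here refl))
  Unique-∷ʳ-≢ {_ ∷ _}  (_ ∷ u)  (there y∈)  = Unique-∷ʳ-≢ u y∈

module Walks {n} (G : LGraph n) where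
  open LGraph G

  walk-last : ∀ {a b ps} → Walk G a b ps → ∃ λ init → ps ≡ init ∷ʳ b
  walk-last (here a) = [] , refl
  walk-last (step {a = a} _ w) with walk-last w
  ... | init , refl = a ∷ init , refl

  walk-inner : ∀ {a b ps} → Walk G a b ps → a ≢ b → ∃ λ mid → ps ≡ a ∷ mid ∷ʳ b
  walk-inner (here a)   a≢a = ⊥-elim (a≢a refl)
  walk-inner (step _ w) _   with walk-last w
  ... | mid , refl = mid , refl

  walk-∷ʳ : ∀ {a b c ps} → Walk G a b ps → Adj b c → Walk G a c (ps ∷ʳ c)
  walk-∷ʳ (here a)     b~c = step b~c (here _)
  walk-∷ʳ (step a~ w) b~c = step a~ (walk-∷ʳ w b~c)

  inner-neighbours : (Adj-sym : ∀ {u v} → Adj u v → Adj v u) →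
                     ∀ {a b ps v} → Walk G a b ps → Unique ps → v ∈ ps → v ≢ a → v ≢ b →
                     ∃₂ λ u w → Adj v u × Adj v w × u ≢ w × u ∈ ps × w ∈ ps
  inner-neighbours Adj-sym (here a)   _ (here v≡a) v≢a _ = ⊥-elim (v≢a v≡a)
  inner-neighbours Adj-sym (step _ _) _ (here v≡a) v≢a _ = ⊥-elim (v≢a v≡a)
  inner-neighbours Adj-sym (step _ (here _)) _ (there (here refl)) _ v≢b = ⊥-elim (v≢b refl)
  inner-neighbours Adj-sym {a} (step a~c (step c~d (here _))) (a∉ ∷ _) (there (here refl)) _ _ =
    a , _ , Adj-sym a~c , c~d , All.lookup a∉ (there (here refl)) , here refl , there (there (here refl))
  inner-neighbours Adj-sym {a} (step a~c (step c~d (step _ _))) (a∉ ∷ _) (there (here refl)) _ _ =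
    a , _ , Adj-sym a~c , c~d , All.lookup a∉ (there (here refl)) , here refl , there (there (here refl))
  inner-neighbours Adj-sym (step _ (here _)) (_ ∷ _ ∷ _) (there (there ())) _ _
  inner-neighbours Adj-sym (step _ w@(step _ _)) (_ ∷ c∉ ∷ u) (there (there v∈)) _ v≢b
    with inner-neighbours Adj-sym w (c∉ ∷ u) (there v∈) (λ v≡c → All.lookup c∉ v∈ (sym v≡c)) v≢b
  ... | u′ , w′ , v~u , v~w , u≢w , u∈ , w∈ = u′ , w′ , v~u , v~w , u≢w , there u∈ , there w∈

  module _ (S : Fin n → Set) where

    suppressed-not-three-neighbours : ∀ {v x y z} → Deg2 G S v →
      Adj v x → InSub G S x → Adj v y → InSub G S y → Adj v z → InSub G S z →
      x ≢ y → y ≢ z → x ≢ z → ⊥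
    suppressed-not-three-neighbours (_ , _ , _ , _ , _ , only) v~x x∈ v~y y∈ v~z z∈ x≢y y≢z x≢z
      with only _ v~x x∈ | only _ v~y y∈ | only _ v~z z∈
    ... | inj₁ refl | inj₁ refl | _         = x≢y refl
    ... | inj₁ refl | inj₂ refl | inj₁ refl = x≢z refl
    ... | inj₁ refl | inj₂ refl | inj₂ refl = y≢z refl
    ... | inj₂ refl | inj₂ refl | _         = x≢y refl
    ... | inj₂ refl | inj₁ refl | inj₁ refl = y≢z refl
    ... | inj₂ refl | inj₁ refl | inj₂ refl = x≢z refl

module CaterpillarGeometry (n′ : ℕ) where

  N : ℕ
  N = suc (suc (suc n′))

  Vertex : Set
  Vertex = CatV N

  Adjacent : Vertex → Vertex → Set
  Adjacent u v = CatE N u v ⊎ CatE N v u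

  spineOf : Fin N → ℕ
  spineOf p = (toℕ p ∸ 1) ⊓ n′

  coord : Vertex → ℕ
  coord (lf p) = spineOf p
  coord (sp k) = toℕ k

  Adjacent-sym : ∀ {u v} → Adjacent u v → Adjacent v u
  Adjacent-sym = Sum.swap

  leaf-neighbour : ∀ {p v} → Adjacent (lf p) v → ∃ λ k → v ≡ sp k × toℕ k ≡ spineOf p
  leaf-neighbour (inj₁ (leaf-spine p k k≡)) = k , refl , k≡
  leaf-neighbour (inj₁ (leaf-leaf () _ _ _ _))
  leaf-neighbour (inj₂ (leaf-leaf () _ _ _ _))

  coord-step : ∀ {u v} → Adjacent u v → coord v ≤ suc (coord u)
  coord-step (inj₁ (leaf-spine p k k≡)) rewrite k≡ = n≤1+n _
  coord-step (inj₁ (spine-spine k k′ k′≡)) rewrite k′≡ = ≤-refl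
  coord-step (inj₁ (leaf-leaf () _ _ _ _))
  coord-step (inj₂ (leaf-spine p k k≡)) rewrite k≡ = n≤1+n _
  coord-step (inj₂ (spine-spine k k′ k′≡)) rewrite sym k′≡ = ≤-trans (n≤1+n _) (n≤1+n _)
  coord-step (inj₂ (leaf-leaf () _ _ _ _))

  sp-cong : ∀ {k k′ : Fin (suc n′)} → toℕ k ≡ toℕ k′ → sp {N} k ≡ sp k′
  sp-cong k≡k′ = cong sp (toℕ-injective k≡k′)

  sp-≢ : ∀ {k k′ : Fin (suc n′)} → toℕ k ≢ toℕ k′ → sp {N} k ≢ sp k′
  sp-≢ k≢k′ refl = k≢k′ refl

  spineOf-mono : ∀ {p q : Fin N} → toℕ p ≤ toℕ q → spineOf p ≤ spineOf q
  spineOf-mono p≤q = ⊓-monoˡ-≤ n′ (∸-monoˡ-≤ 1 p≤q)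

  spineOf-inner : ∀ {y x z : Fin N} → toℕ y < toℕ x → toℕ x < toℕ z → suc (spineOf x) ≡ toℕ x
  spineOf-inner {y} {x} {z} y<x x<z = unclamped (toℕ x) y<x (<-≤-trans x<z (≤-pred (toℕ<n z)))
    where
    unclamped : ∀ a → toℕ y < a → a < suc (suc n′) → suc ((a ∸ 1) ⊓ n′) ≡ a
    unclamped (suc a) _ (s≤s a≤) = cong suc (m≤n⇒m⊓n≡m (≤-pred a≤))

  module OnCaterpillar (σ : Permutation′ N) where

    T : LGraph N
    T = Caterpillar N σ

    open Walks T public

    walk-hits : ∀ {a b ps e} → Walk T a b ps → Between (coord a) e (coord b) → ∃ λ v → v ∈ ps × coord v ≡ e
    walk-hits w (inj₁ (a≤e , e≤b)) = upwards w a≤e e≤b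
      where
      upwards : ∀ {a b ps e} → Walk T a b ps → coord a ≤ e → e ≤ coord b → ∃ λ v → v ∈ ps × coord v ≡ e
      upwards (here a) a≤e e≤a = a , here refl , ≤-antisym a≤e e≤a
      upwards {a} {e = e} (step a~c w) a≤e e≤b with coord a ≟ e
      ... | yes a≡e = a , here refl , a≡e
      ... | no  a≢e with upwards w (≤-trans (coord-step a~c) (≤∧≢⇒< a≤e a≢e)) e≤b
      ...   | v , v∈ , v≡e = v , there v∈ , v≡e
    walk-hits w (inj₂ (b≤e , e≤a)) = downwards w e≤a b≤e
      where
      downwards : ∀ {a b ps e} → Walk T a b ps → e ≤ coord a → coord b ≤ e → ∃ λ v → v ∈ ps × coord v ≡ e
      downwards (here a) e≤a a≤e = a , here refl , ≤-antisym a≤e e≤a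
      downwards {a} {e = e} (step a~c w) e≤a b≤e with coord a ≟ e
      ... | yes a≡e = a , here refl , a≡e
      ... | no  a≢e with downwards w (≤-pred (≤-trans (≤∧≢⇒< e≤a (a≢e ∘ sym)) (coord-step (Adjacent-sym a~c)))) b≤e
      ...   | v , v∈ , v≡e = v , there v∈ , v≡e

    leaf-neighbour-unique : ∀ {u w q} → Adjacent u (lf q) → Adjacent (lf q) w → u ≡ w
    leaf-neighbour-unique u~q q~w with leaf-neighbour (Adjacent-sym u~q) | leaf-neighbour q~w
    ... | _ , refl , k≡ | _ , refl , k′≡ = sp-cong (trans k≡ (sym k′≡))

    leaf-on-path : ∀ {a b ps q} → Walk T a b ps → Unique ps → lf q ∈ ps → lf q ≡ a ⊎ lf q ≡ b
    leaf-on-path (here _)   _ (here q≡a) = inj₁ q≡a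
    leaf-on-path (step _ _) _ (here q≡a) = inj₁ q≡a
    leaf-on-path (step a~c w) (a∉ ∷ u) (there q∈) with leaf-on-path w u q∈
    ... | inj₂ q≡b  = inj₂ q≡b
    ... | inj₁ refl = leaf-is-end a~c w a∉
      where
      leaf-is-end : ∀ {a q b ps} → Adjacent a (lf q) → Walk T (lf q) b ps → All (a ≢_) ps → lf q ≡ a ⊎ lf q ≡ b
      leaf-is-end a~q (here _)                  _             = inj₂ refl
      leaf-is-end a~q (step q~d (here _))   (_ ∷ a≢d ∷ _) = ⊥-elim (a≢d (leaf-neighbour-unique a~q q~d))
      leaf-is-end a~q (step q~d (step _ _)) (_ ∷ a≢d ∷ _) = ⊥-elim (a≢d (leaf-neighbour-unique a~q q~d))

    module Restriction (S : Fin N → Set) where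

      leaf-not-suppressed : ∀ {p} → ¬ Deg2 T S (lf p)
      leaf-not-suppressed (_ , _ , u≢w , (p~u , _) , (p~w , _) , _) with leaf-neighbour p~u | leaf-neighbour p~w
      ... | _ , refl , k≡ | _ , refl , k′≡ = u≢w (sp-cong (trans k≡ (sym k′≡)))

      InSub-leaf : ∀ {q} → InSub T S (lf q) → ∃ λ x → S x × lf (σ ⟨$⟩ˡ x) ≡ lf q
      InSub-leaf (x , y , sx , sy , ps , (w , u) , q∈) with leaf-on-path w u q∈
      ... | inj₁ q≡x = x , sx , sym q≡x
      ... | inj₂ q≡y = y , sy , sym q≡y

      InSubAt SuppressedAt : ℕ → Set
      InSubAt e = ∃ λ k → toℕ k ≡ e × InSub T S (sp k)
      SuppressedAt e = ∃ λ k → toℕ k ≡ e × InSub T S (sp k) × Deg2 T S (sp k)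

      suppressed-inner : ∀ {mid v} → All (λ v → InSub T S v × Deg2 T S v) mid → v ∈ mid → SuppressedAt (coord v)
      suppressed-inner {v = lf p} all v∈ = ⊥-elim (leaf-not-suppressed (proj₂ (All.lookup all v∈)))
      suppressed-inner {v = sp k} all v∈ = k , refl , All.lookup all v∈

      suppressed-at : ∀ {mid b v} → All (λ v → InSub T S v × Deg2 T S v) mid → v ∈ mid ∷ʳ b →
                      coord v ≢ coord b → SuppressedAt (coord v)
      suppressed-at {mid} all v∈ v≢b with ∈-++⁻ mid v∈
      ... | inj₁ v∈mid       = suppressed-inner all v∈mid
      ... | inj₂ (here refl) = ⊥-elim (v≢b refl)

      kept-not-suppressed : ∀ {k} → Kept T S (sp k) → ¬ SuppressedAt (toℕ k)
      kept-not-suppressed (_ , not-deg2) (_ , k′≡k , _ , deg2) = not-deg2 (subst (Deg2 T S) (sp-cong k′≡k) deg2)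

      suppressed-from-leaf : ∀ {p c e} → RAdj T S (lf p) (sp c) → Between (spineOf p) e (toℕ c) → e ≢ toℕ c →
                             SuppressedAt e
      suppressed-from-leaf (_ , _ , _ , (step p~s w , _) , all) between e≢c with leaf-neighbour p~s
      ... | k , refl , k≡ with walk-hits w (subst (λ a → Between a _ _) (sym k≡) between)
      ...   | v , v∈ , refl = suppressed-at all v∈ e≢c

      no-kept-between : ∀ {c d e} → RAdj T S (sp c) (sp d) → Kept T S (sp e) →
                        ¬ StrictlyBetween (toℕ c) (toℕ e) (toℕ d)
      no-kept-between (_ , _ , _ , (w , _) , all) e-kept between with walk-hits w (strict⇒Between between)
      ... | _ , here refl , e≡c  = StrictlyBetween-≢ˡ between (sym e≡c)
      ... | v , there v∈  , v≡e  = kept-not-suppressed e-kept (subst SuppressedAt v≡e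
                                     (suppressed-at all v∈ (StrictlyBetween-≢ʳ between ∘ trans (sym v≡e))))

      InSubAt-from-leaf : ∀ {p c e} → RAdj T S (lf p) (sp c) → Between (spineOf p) e (toℕ c) → InSubAt e
      InSubAt-from-leaf {c = c} {e} r@(_ , (c∈ , _) , _) between with e ≟ toℕ c
      ... | yes refl = c , refl , c∈
      ... | no  e≢c with suppressed-from-leaf r between e≢c
      ...   | k , k≡ , k∈ , _ = k , k≡ , k∈

      -- the spine vertex of q would be suppressed yet have three neighbours in the subtree
      leaves-cross : ∀ {p q c d} → RAdj T S (lf p) (sp c) → RAdj T S (lf q) (sp d) →
                     spineOf p ≤ spineOf q → toℕ d < spineOf p → spineOf q < toℕ c → ⊥
      leaves-cross {p} {q} {c} {d} rp rq p≤q d<p q<c = cross (pred (spineOf q)) (sym (suc-pred (spineOf q)))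
        where
        instance
          q-nonZero : NonZero (spineOf q)
          q-nonZero = >-nonZero (≤-<-trans z≤n (<-≤-trans d<p p≤q))
        cross : ∀ j → spineOf q ≡ suc j → ⊥
        cross j q≡
          with suppressed-from-leaf rp (inj₁ (p≤q , <⇒≤ q<c)) (<⇒≢ q<c)
             | InSubAt-from-leaf rp (inj₁ (≤-trans p≤q (n≤1+n _) , q<c))
             | InSubAt-from-leaf rq (inj₂ (≤-pred (subst (toℕ d <_) q≡ (<-≤-trans d<p p≤q)) ,
                                           ≤-trans (n≤1+n j) (≤-reflexive (sym q≡))))
        ... | t , t≡ , _ , t-suppressed | u , u≡ , u∈ | w , w≡ , w∈ =
          suppressed-not-three-neighbours S t-suppressed
            (inj₂ (leaf-spine q t t≡)) (proj₁ (proj₁ rq))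
            (inj₁ (spine-spine t u (trans (cong suc t≡) (sym u≡)))) u∈
            (inj₂ (spine-spine w t (trans (cong suc w≡) (trans (sym q≡) (sym t≡))))) w∈
            (λ ()) (sp-≢ λ u≡w → <⇒≢ w<u (sym u≡w)) (λ ())
          where
          w<u : toℕ w < toℕ u
          w<u rewrite w≡ | u≡ | q≡ = n≤1+n _

      leaf-neighbours-ordered : ∀ {p q c d} → RAdj T S (lf p) (sp c) → RAdj T S (lf q) (sp d) →
                                spineOf p ≤ spineOf q → toℕ c ≤ toℕ d
      leaf-neighbours-ordered {p} {q} {c} {d} rp rq p≤q with toℕ c ≤? toℕ d
      ... | yes c≤d = c≤d
      ... | no  c≰d with spineOf p ≤? toℕ d | toℕ c ≤? spineOf q
      ...   | yes p≤d | _       = ⊥-elim (kept-not-suppressed (proj₁ (proj₂ rq))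
                                    (suppressed-from-leaf rp (inj₁ (p≤d , <⇒≤ (≰⇒> c≰d))) (<⇒≢ (≰⇒> c≰d))))
      ...   | no _    | yes c≤q = ⊥-elim (kept-not-suppressed (proj₁ (proj₂ rp))
                                    (suppressed-from-leaf rq (inj₂ (<⇒≤ (≰⇒> c≰d) , c≤q)) (>⇒≢ (≰⇒> c≰d))))
      ...   | no p≰d  | no c≰q  = ⊥-elim (leaves-cross rp rq p≤q (≰⇒> p≰d) (≰⇒> c≰q))

  spineOf≤ : ∀ p → spineOf p ≤ n′
  spineOf≤ p = m⊓n≤n _ _

  spineIndex : ℕ → Fin (suc n′)
  spineIndex k = fromℕ< {k ⊓ n′} (s≤s (m⊓n≤n k n′))

  spine : ℕ → Vertex
  spine k = sp (spineIndex k)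

  toℕ-spineIndex : ∀ {k} → k ≤ n′ → toℕ (spineIndex k) ≡ k
  toℕ-spineIndex k≤n = trans (toℕ-fromℕ< _) (m≤n⇒m⊓n≡m k≤n)

  spine-injective : ∀ {k k′} → k ≤ n′ → k′ ≤ n′ → spine k ≡ spine k′ → k ≡ k′
  spine-injective {k} {k′} k≤n k′≤n same =
    trans (sym (toℕ-spineIndex k≤n)) (trans (cong (λ { (sp i) → toℕ i ; (lf _) → 0 }) same) (toℕ-spineIndex k′≤n))

  leaf~spine : ∀ p → Adjacent (lf p) (spine (spineOf p))
  leaf~spine p = inj₁ (leaf-spine p _ (toℕ-spineIndex (spineOf≤ p)))

  spine~spine : ∀ k → suc k ≤ n′ → Adjacent (spine k) (spine (suc k))
  spine~spine k k<n = inj₁ (spine-spine _ _ (trans (cong suc (toℕ-spineIndex (<⇒≤ k<n))) (sym (toℕ-spineIndex k<n))))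

  spine-neighbours : ∀ {k v} → Adjacent (sp k) v →
    (∃ λ p → v ≡ lf p × spineOf p ≡ toℕ k) ⊎
    (∃ λ k′ → v ≡ sp k′ × (toℕ k′ ≡ suc (toℕ k) ⊎ suc (toℕ k′) ≡ toℕ k))
  spine-neighbours (inj₁ (spine-spine _ k′ k′≡)) = inj₂ (k′ , refl , inj₁ (sym k′≡))
  spine-neighbours (inj₂ (leaf-spine p _ k≡))   = inj₁ (p , refl , sym k≡)
  spine-neighbours (inj₂ (spine-spine k′ _ k≡))  = inj₂ (k′ , refl , inj₂ k≡)

  leaf-of-inner-spine : ∀ {p k} → spineOf p ≡ k → 0 < k → k < n′ → toℕ p ≡ suc k
  leaf-of-inner-spine {p} {k} p≡k 0<k k<n with toℕ p ≤? suc n′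
  ... | no  p>  = ⊥-elim (<⇒≢ k<n (trans (sym p≡k) (m≥n⇒m⊓n≡n (≤-trans (n≤1+n n′) (∸-monoˡ-≤ 1 (≰⇒> p>))))))
  ... | yes p≤ with toℕ p | p≡k
  ...   | zero  | p≡k′ = ⊥-elim (<⇒≢ 0<k p≡k′)
  ...   | suc a | p≡k′ = cong suc (trans (sym (m≤n⇒m⊓n≡m (≤-pred p≤))) p≡k′)

  spineRun : ℕ → ℕ → List Vertex
  spineRun i zero    = spine i ∷ []
  spineRun i (suc d) = spine i ∷ spineRun (suc i) d

  ∈-spineRun : ∀ i d {k} → i ≤ k → k ≤ i + d → spine k ∈ spineRun i d
  ∈-spineRun i zero    i≤k k≤i rewrite +-identityʳ i = here (cong spine (≤-antisym k≤i i≤k))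
  ∈-spineRun i (suc d) {k} i≤k k≤ with k ≟ i
  ... | yes refl = here refl
  ... | no  k≢i  = there (∈-spineRun (suc i) d (≤∧≢⇒< i≤k (k≢i ∘ sym)) (≤-trans k≤ (≤-reflexive (+-suc i d))))

  ∈-spineRun⁻ : ∀ i d {v} → v ∈ spineRun i d → ∃ λ k → v ≡ spine k × i ≤ k × k ≤ i + d
  ∈-spineRun⁻ i zero    (here refl) = i , refl , ≤-refl , m≤m+n i 0
  ∈-spineRun⁻ i (suc d) (here refl) = i , refl , ≤-refl , m≤m+n i _
  ∈-spineRun⁻ i (suc d) (there v∈) with ∈-spineRun⁻ (suc i) d v∈
  ... | k , v≡ , i<k , k≤ = k , v≡ , <⇒≤ i<k , ≤-trans k≤ (≤-reflexive (sym (+-suc i d)))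

  spineRun-unique : ∀ i d → i + d ≤ n′ → Unique (spineRun i d)
  spineRun-unique i zero    _   = [] ∷ []
  spineRun-unique i (suc d) i+d≤n = All.tabulate i∉ ∷ spineRun-unique (suc i) d i+d≤n′
    where
    i+d≤n′ : suc i + d ≤ n′
    i+d≤n′ = ≤-trans (≤-reflexive (sym (+-suc i d))) i+d≤n
    i∉ : ∀ {v} → v ∈ spineRun (suc i) d → spine i ≢ v
    i∉ v∈ i≡v with ∈-spineRun⁻ (suc i) d v∈
    ... | k , refl , i<k , k≤ =
      <⇒≢ i<k (spine-injective (≤-trans (n≤1+n i) (≤-trans (m≤m+n (suc i) d) i+d≤n′)) (≤-trans k≤ i+d≤n′) i≡v)

  spineRun-walk : ∀ σ i d → i + d ≤ n′ → Walk (Caterpillar N σ) (spine i) (spine (i + d)) (spineRun i d)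
  spineRun-walk σ i zero    _ rewrite +-identityʳ i = here _
  spineRun-walk σ i (suc d) i+d≤n =
    step (spine~spine i (≤-trans (m≤m+n (suc i) d) i+d≤n′))
         (subst (λ j → Walk (Caterpillar N σ) (spine (suc i)) (spine j) (spineRun (suc i) d)) (sym (+-suc i d))
                (spineRun-walk σ (suc i) d i+d≤n′))
    where
    i+d≤n′ : suc i + d ≤ n′
    i+d≤n′ = ≤-trans (≤-reflexive (sym (+-suc i d))) i+d≤n

  spinePath : ℕ → ℕ → List Vertex
  spinePath a b = spineRun a (b ∸ a)

  module _ {a b : ℕ} (a≤b : a ≤ b) (b≤n : b ≤ n′) where

    private
      end : a + (b ∸ a) ≡ b
      end = m+[n∸m]≡n a≤b

    spinePath-walk : ∀ σ → Walk (Caterpillar N σ) (spine a) (spine b) (spinePath a b)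
    spinePath-walk σ = subst (λ j → Walk (Caterpillar N σ) (spine a) (spine j) (spinePath a b)) end
                             (spineRun-walk σ a (b ∸ a) (≤-trans (≤-reflexive end) b≤n))

    spinePath-unique : Unique (spinePath a b)
    spinePath-unique = spineRun-unique a (b ∸ a) (≤-trans (≤-reflexive end) b≤n)

    ∈-spinePath : ∀ {k} → a ≤ k → k ≤ b → spine k ∈ spinePath a b
    ∈-spinePath a≤k k≤b = ∈-spineRun a (b ∸ a) a≤k (≤-trans k≤b (≤-reflexive (sym end)))

    ∈-spinePath⁻ : ∀ {v} → v ∈ spinePath a b → ∃ λ k → v ≡ spine k × a ≤ k × k ≤ b
    ∈-spinePath⁻ v∈ with ∈-spineRun⁻ a (b ∸ a) v∈
    ... | k , v≡ , a≤k , k≤ = k , v≡ , a≤k , ≤-trans k≤ (≤-reflexive end)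

  module IdentityRestriction (S : Fin N → Set) where

    open OnCaterpillar id public
    open Restriction S public

    lf-injective : ∀ {a b : Fin N} → lf {N} a ≡ lf b → a ≡ b
    lf-injective refl = refl

    leaf-InSub : ∀ {x} → S x → InSub T S (lf x)
    leaf-InSub {x} sx = x , x , sx , sx , lf x ∷ [] , (here _ , [] ∷ []) , here refl

    leafPath : Fin N → Fin N → List Vertex
    leafPath y z = lf y ∷ spinePath (spineOf y) (spineOf z) ∷ʳ lf z

    module _ {y z : Fin N} (y≤z : spineOf y ≤ spineOf z) where

      leafPath-walk : Walk T (lf y) (lf z) (leafPath y z)
      leafPath-walk = step (leaf~spine y) (walk-∷ʳ (spinePath-walk y≤z (spineOf≤ z) id) (Adjacent-sym (leaf~spine z)))

      leafPath-unique : y ≢ z → Unique (leafPath y z)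
      leafPath-unique y≢z = All.tabulate y∉ ∷ Unique-∷ʳ (spinePath-unique y≤z (spineOf≤ z)) (All.tabulate spine≢leaf)
        where
        spine≢leaf : ∀ {v q} → v ∈ spinePath (spineOf y) (spineOf z) → v ≢ lf q
        spine≢leaf v∈ with ∈-spinePath⁻ y≤z (spineOf≤ z) v∈
        ... | _ , refl , _ = λ ()
        y∉ : ∀ {v} → v ∈ spinePath (spineOf y) (spineOf z) ∷ʳ lf z → lf y ≢ v
        y∉ v∈ with ∈-++⁻ (spinePath (spineOf y) (spineOf z)) v∈
        ... | inj₁ v∈run       = spine≢leaf v∈run ∘ sym
        ... | inj₂ (here refl) = y≢z ∘ lf-injective

      ∈-leafPath : ∀ {k} → spineOf y ≤ k → k ≤ spineOf z → spine k ∈ leafPath y z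
      ∈-leafPath y≤k k≤z = there (∈-++⁺ˡ (∈-spinePath y≤z (spineOf≤ z) y≤k k≤z))

      InSub-leafPath : S y → S z → y ≢ z → ∀ {v} → v ∈ leafPath y z → InSub T S v
      InSub-leafPath sy sz y≢z v∈ = y , z , sy , sz , leafPath y z , (leafPath-walk , leafPath-unique y≢z) , v∈

    module _ {y z : Fin N} (sy : S y) (sz : S z) where

      -- leaf x and the two neighbours on the path from y to z give the spine vertex of x degree 3
      inner-spine-kept : ∀ {x} → S x → toℕ y < toℕ x → toℕ x < toℕ z → Kept T S (spine (spineOf x))
      inner-spine-kept {x} sx y<x x<z = InSub-leafPath y≤z sy sz y≢z x∈ , not-suppressed
        where
        y≤z : spineOf y ≤ spineOf z
        y≤z = spineOf-mono (<⇒≤ (<-trans y<x x<z))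
        y≢z : y ≢ z
        y≢z refl = <-irrefl refl (<-trans y<x x<z)
        x∈ : spine (spineOf x) ∈ leafPath y z
        x∈ = ∈-leafPath y≤z (spineOf-mono (<⇒≤ y<x)) (spineOf-mono (<⇒≤ x<z))
        walk : Walk T (lf y) (lf z) (leafPath y z)
        walk = leafPath-walk y≤z
        unique : Unique (leafPath y z)
        unique = leafPath-unique y≤z y≢z
        x∉ : ∀ {u} → u ∈ leafPath y z → lf x ≢ u
        x∉ u∈ refl with leaf-on-path walk unique u∈
        ... | inj₁ x≡y = <⇒≢ y<x (sym (cong toℕ (lf-injective x≡y)))
        ... | inj₂ x≡z = <⇒≢ x<z (cong toℕ (lf-injective x≡z))
        not-suppressed : ¬ Deg2 T S (spine (spineOf x))
        not-suppressed deg2 with inner-neighbours Adjacent-sym walk unique x∈ (λ ()) (λ ())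
        ... | u , w , x~u , x~w , u≢w , u∈ , w∈ =
          suppressed-not-three-neighbours S deg2 (Adjacent-sym (leaf~spine x)) (leaf-InSub sx)
            x~u (InSub-leafPath y≤z sy sz y≢z u∈) x~w (InSub-leafPath y≤z sy sz y≢z w∈) (x∉ u∈) u≢w (x∉ w∈)

      inner-leaf-edge : ∀ {x} → S x → toℕ y < toℕ x → toℕ x < toℕ z → RAdj T S (lf x) (spine (spineOf x))
      inner-leaf-edge {x} sx y<x x<z = (leaf-InSub sx , leaf-not-suppressed) , inner-spine-kept sx y<x x<z ,
                                        [] , (step (leaf~spine x) (here _) , ((λ ()) ∷ []) ∷ [] ∷ []) , []

    module Consecutive {y x x′ z : Fin N} (sy : S y) (sz : S z) (sx : S x) (sx′ : S x′)
      (y<x : toℕ y < toℕ x) (x<x′ : toℕ x < toℕ x′) (x′<z : toℕ x′ < toℕ z)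
      (nothing-between : ∀ p → S p → toℕ x < toℕ p → toℕ p < toℕ x′ → ⊥) where

      private
        x≡ : suc (spineOf x) ≡ toℕ x
        x≡ = spineOf-inner y<x (<-trans x<x′ x′<z)
        x′≡ : suc (spineOf x′) ≡ toℕ x′
        x′≡ = spineOf-inner (<-trans y<x x<x′) x′<z
        x<x′ₛ : spineOf x < spineOf x′
        x<x′ₛ = ≤-pred (subst₂ _<_ (sym x≡) (sym x′≡) x<x′)
        x≤x′ₛ : spineOf x ≤ spineOf x′
        x≤x′ₛ = <⇒≤ x<x′ₛ
        x≢x′ : x ≢ x′
        x≢x′ refl = <-irrefl refl x<x′
        x≢x′ₛ : spine (spineOf x) ≢ spine (spineOf x′)
        x≢x′ₛ = <⇒≢ x<x′ₛ ∘ spine-injective (spineOf≤ x) (spineOf≤ x′)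
        InSub-between : ∀ {k} → spineOf x ≤ k → k ≤ spineOf x′ → InSub T S (spine k)
        InSub-between x≤k k≤x′ = InSub-leafPath x≤x′ₛ sx sx′ x≢x′ (∈-leafPath x≤x′ₛ x≤k k≤x′)

      suppressed-between : ∀ k → spineOf x < k → k < spineOf x′ → Deg2 T S (spine k)
      suppressed-between (suc j) x<k k<x′ =
        spine j , spine (suc (suc j)) , j≢2+j ,
        (Adjacent-sym (spine~spine j (<⇒≤ 1+j<n)) , InSub-between (≤-pred x<k) (≤-trans (n≤1+n j) (<⇒≤ k<x′))) ,
        (spine~spine (suc j) 1+j<n , InSub-between (≤-trans (<⇒≤ x<k) (n≤1+n _)) k<x′) ,
        only
        where
        1+j<n : suc j < n′
        1+j<n = <-≤-trans k<x′ (spineOf≤ x′)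
        toℕ-1+j : toℕ (spineIndex (suc j)) ≡ suc j
        toℕ-1+j = toℕ-spineIndex (<⇒≤ 1+j<n)
        toℕ-j : toℕ (spineIndex j) ≡ j
        toℕ-j = toℕ-spineIndex (≤-trans (n≤1+n j) (<⇒≤ 1+j<n))
        j≢2+j : spine j ≢ spine (suc (suc j))
        j≢2+j same = <⇒≢ (m<n⇒m<1+n (n<1+n j)) (spine-injective (≤-trans (n≤1+n j) (<⇒≤ 1+j<n)) 1+j<n same)
        only : ∀ w → Adjacent (spine (suc j)) w → InSub T S w → w ≡ spine j ⊎ w ≡ spine (suc (suc j))
        only w j~w w∈ with spine-neighbours j~w
        ... | inj₂ (k′ , refl , inj₁ k′≡) = inj₂ (sp-cong (trans k′≡ (trans (cong suc toℕ-1+j) (sym (toℕ-spineIndex 1+j<n)))))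
        ... | inj₂ (k′ , refl , inj₂ k′≡) = inj₁ (sp-cong (trans (suc-injective (trans k′≡ toℕ-1+j)) (sym toℕ-j)))
        ... | inj₁ (p , refl , p≡) with InSub-leaf w∈
        ...   | x″ , sx″ , x″≡p = ⊥-elim (nothing-between p (subst S (lf-injective x″≡p) sx″)
                                       (subst₂ _<_ x≡ (sym p-position) (s≤s (s≤s (≤-pred x<k))))
                                       (subst₂ _<_ (sym p-position) x′≡ (s≤s k<x′)))
          where
          p-position : toℕ p ≡ suc (suc j)
          p-position = leaf-of-inner-spine (trans p≡ toℕ-1+j) (s≤s z≤n) 1+j<n

      consecutive-spines-edge : RAdj T S (spine (spineOf x)) (spine (spineOf x′))
      consecutive-spines-edge with walk-inner (spinePath-walk x≤x′ₛ (spineOf≤ x′) id) x≢x′ₛ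
      ... | mid , path≡ =
        inner-spine-kept sy sz sx y<x (<-trans x<x′ x′<z) ,
        inner-spine-kept sy sz sx′ (<-trans y<x x<x′) x′<z ,
        mid , (subst (Walk T _ _) path≡ (spinePath-walk x≤x′ₛ (spineOf≤ x′) id) , unique) ,
        All.tabulate inner
        where
        unique : Unique (spine (spineOf x) ∷ mid ∷ʳ spine (spineOf x′))
        unique = subst Unique path≡ (spinePath-unique x≤x′ₛ (spineOf≤ x′))
        inner : ∀ {v} → v ∈ mid → InSub T S v × Deg2 T S v
        inner {v} v∈ with ∈-spinePath⁻ x≤x′ₛ (spineOf≤ x′) (subst (v ∈_) (sym path≡) (there (∈-++⁺ˡ v∈)))
        ... | k , refl , x≤k , k≤x′ with unique
        ...   | x∉ ∷ rest-unique =
          InSub-between x≤k k≤x′ ,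
          suppressed-between k (≤∧≢⇒< x≤k λ { refl → All.lookup x∉ (∈-++⁺ˡ v∈) refl })
                               (≤∧≢⇒< k≤x′ λ { refl → Unique-∷ʳ-≢ rest-unique v∈ refl })

-- The inner elements of an agreeing block

Interior : ∀ {n} → (Fin n → Set) → Fin n → Set
Interior S x = S x × (∃ λ y → S y × toℕ y < toℕ x) × (∃ λ z → S z × toℕ x < toℕ z)

interior? : ∀ {n} {S : Fin n → Set} → Decidable S → Decidable (Interior S)
interior? S? x = S? x ×-dec any? (λ y → S? y ×-dec (toℕ y <? toℕ x)) ×-dec any? (λ z → S? z ×-dec (toℕ x <? toℕ z))

Interior-convex : ∀ {n} {S : Fin n → Set} {x x′ p} → Interior S x → Interior S x′ → S p →
                  toℕ x < toℕ p → toℕ p < toℕ x′ → Interior S p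
Interior-convex (sx , _ , _) (sx′ , _ , _) sp′ x<p p<x′ = sp′ , (_ , sx , x<p) , (_ , sx′ , p<x′)

module _ {n} (π : Permutation′ n) {P : Fin n → Set} (val : ∀ x → P x → ℕ)
  (val-follows-position : ∀ {x x′} px px′ → position π x < position π x′ → val x px ≤ val x′ px′) where

  increasing : (∀ x x′ px px′ → toℕ x < toℕ x′ → val x px < val x′ px′) → Increasing π P
  increasing up x x′ px px′ before with <-cmp (toℕ x) (toℕ x′)
  ... | tri< x<x′ _ _ = x<x′
  ... | tri≈ _ x≡x′ _ = ⊥-elim (<-irrefl (cong (position π) (toℕ-injective x≡x′)) before)
  ... | tri> _ _ x′<x = ⊥-elim (<⇒≱ (up x′ x px′ px x′<x) (val-follows-position px px′ before))

  decreasing : (∀ x x′ px px′ → toℕ x < toℕ x′ → val x′ px′ < val x px) → Decreasing π P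
  decreasing down x x′ px px′ before with <-cmp (toℕ x) (toℕ x′)
  ... | tri< x<x′ _ _ = ⊥-elim (<⇒≱ (down x x′ px px′ x<x′) (val-follows-position px px′ before))
  ... | tri≈ _ x≡x′ _ = ⊥-elim (<-irrefl (cong (position π) (toℕ-injective x≡x′)) before)
  ... | tri> _ _ x′<x = x′<x

module InteriorOfAgreeingBlock (n′ : ℕ) (π : Permutation′ (suc (suc (suc n′)))) (S : Fin (suc (suc (suc n′))) → Set)
  (S? : Decidable S)
  (R : CatV (suc (suc (suc n′))) → CatV (suc (suc (suc n′))) → Set)
  (kept : ∀ {u v} → R u v → Kept (Caterpillar _ id) S u × Kept (Caterpillar _ π) S v)
  (functional : ∀ {u v v′} → R u v → R u v′ → v ≡ v′)
  (injective : ∀ {u u′ v} → R u v → R u′ v → u ≡ u′)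
  (total : ∀ u → Kept (Caterpillar _ id) S u → ∃ (R u))
  (leaves : ∀ x → S x → R (lf x) (lf (π ⟨$⟩ˡ x)))
  (edges : ∀ {u u′ v v′} → R u v → R u′ v′ → RAdj (Caterpillar _ id) S u u′ → RAdj (Caterpillar _ π) S v v′)
  where

  open CaterpillarGeometry n′
  module T₁ = IdentityRestriction S
  module T₂ where
    open OnCaterpillar π public
    open Restriction S public

  spine-kept : ∀ {x} → Interior S x → Kept T₁.T S (spine (spineOf x))
  spine-kept (sx , (_ , sy , y<x) , (_ , sz , x<z)) = T₁.inner-spine-kept sy sz sx y<x x<z

  leaf-edge : ∀ {x} → Interior S x → RAdj T₁.T S (lf x) (spine (spineOf x))
  leaf-edge (sx , (_ , sy , y<x) , (_ , sz , x<z)) = T₁.inner-leaf-edge sy sz sx y<x x<z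

  x-position : ∀ {x} → Interior S x → suc (spineOf x) ≡ toℕ x
  x-position (_ , (_ , _ , y<x) , (_ , _ , x<z)) = spineOf-inner y<x x<z

  image : ∀ {x} → Interior S x → ∃ λ k → R (spine (spineOf x)) (sp k)
  image ix with total _ (spine-kept ix)
  ... | sp k , r = k , r
  ... | lf p , r with T₂.InSub-leaf (proj₁ (proj₂ (kept r)))
  ...   | x″ , sx″ , x″≡p with injective r (subst (R (lf x″)) x″≡p (leaves x″ sx″))
  ...     | ()

  val : ∀ x → Interior S x → ℕ
  val x ix = toℕ (proj₁ (image ix))

  private
    sp-injective : ∀ {k k′ : Fin (suc n′)} → sp {N} k ≡ sp k′ → k ≡ k′
    sp-injective refl = refl

  val-irrelevant : ∀ x ix ix′ → val x ix ≡ val x ix′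
  val-irrelevant x ix ix′ = cong toℕ (sp-injective (functional (proj₂ (image ix)) (proj₂ (image ix′))))

  val-injective : ∀ x x′ ix ix′ → val x ix ≡ val x′ ix′ → x ≡ x′
  val-injective x x′ ix ix′ same = toℕ-injective (begin
      toℕ x                 ≡⟨ sym (x-position ix) ⟩
      suc (spineOf x)       ≡⟨ cong suc (spine-injective (spineOf≤ x) (spineOf≤ x′) same-spine) ⟩
      suc (spineOf x′)      ≡⟨ x-position ix′ ⟩
      toℕ x′                ∎)
    where
    open ≡-Reasoning
    same-spine : spine (spineOf x) ≡ spine (spineOf x′)
    same-spine = injective (proj₂ (image ix)) (subst (R _) (cong sp (sym (toℕ-injective same))) (proj₂ (image ix′)))

  open GapFree (Interior S) (interior? S?) val val-irrelevant val-injective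

  gap-free : GapFreeLabels
  gap-free x x′ w ix@(sx , (_ , sy , y<x) , _) ix′@(sx′ , _ , (_ , sz , x′<z)) iw (x<x′ , nothing-interior) =
    T₂.no-kept-between (edges (proj₂ (image ix)) (proj₂ (image ix′)) consecutive-spines-edge)
                       (proj₂ (kept (proj₂ (image iw))))
    where
    open T₁.Consecutive sy sz sx sx′ y<x x<x′ x′<z
           (λ p sp′ x<p p<x′ → nothing-interior p (Interior-convex ix ix′ sp′ x<p p<x′) x<p p<x′)

  val-follows-position : ∀ {x x′} ix ix′ → position π x < position π x′ → val x ix ≤ val x′ ix′
  val-follows-position {x} {x′} ix ix′ before =
    T₂.leaf-neighbours-ordered (leaf-edge₂ x ix) (leaf-edge₂ x′ ix′) (spineOf-mono (<⇒≤ before))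
    where
    leaf-edge₂ : ∀ x ix → RAdj T₂.T S (lf (π ⟨$⟩ˡ x)) (sp (proj₁ (image ix)))
    leaf-edge₂ x ix = edges (leaves x (proj₁ ix)) (proj₂ (image ix)) (leaf-edge ix)

  interior-monotone : Monotone π (Interior S)
  interior-monotone = Sum.map (increasing π val val-follows-position) (decreasing π val val-follows-position) (monotone gap-free)

Interior-empty : ∀ {n} {S : Fin n → Set} {x} → n ≤ 2 → ¬ Interior S x
Interior-empty n≤2 (_ , (y , _ , y<x) , (z , _ , x<z)) =
  <⇒≱ (<-≤-trans (toℕ<n z) n≤2) (≤-trans (s≤s (≤-trans (s≤s z≤n) y<x)) x<z)

agreeing-block-interior-monotone : ∀ {n} (π : Permutation′ n) {S : Fin n → Set} → Decidable S →
  RestrictEq (Caterpillar n id) (Caterpillar n π) S → Monotone π (Interior S)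
agreeing-block-interior-monotone {suc (suc (suc n′))} π {S} S? (R , kept , functional , injective , total , _ , leaves , edges) =
  InteriorOfAgreeingBlock.interior-monotone n′ π S S? R kept functional injective total leaves (λ r r′ → proj₁ (edges r r′))
agreeing-block-interior-monotone {zero}        π _ _ = inj₁ λ _ _ ix → ⊥-elim (Interior-empty z≤n ix)
agreeing-block-interior-monotone {suc zero}    π _ _ = inj₁ λ _ _ ix → ⊥-elim (Interior-empty (s≤s z≤n) ix)
agreeing-block-interior-monotone {suc (suc zero)} π _ _ = inj₁ λ _ _ ix → ⊥-elim (Interior-empty ≤-refl ix)

module BlockEnds {n k} (f : Fin n → Fin k) (onto : ∀ j → ∃ λ x → f x ≡ j) where

  Block : Fin k → Fin n → Set
  Block j x = f x ≡ j

  private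
    first : ∀ j → ∃ λ x → f x ≡ j × ∀ y → f y ≡ j → toℕ x ≤ toℕ y
    first j = minimum (λ x → f x ≟ᶠ j) (onto j)
    last : ∀ j → ∃ λ x → f x ≡ j × ∀ y → f y ≡ j → toℕ y ≤ toℕ x
    last  j = maximum (λ x → f x ≟ᶠ j) (onto j)

  firstOf lastOf : Fin k → Fin n
  firstOf j = proj₁ (first j)
  lastOf  j = proj₁ (last j)

  ends : List (Fin n)
  ends = tabulate firstOf ++ tabulate lastOf

  length-ends : length ends ≡ 2 * k
  length-ends = begin
    length ends                                        ≡⟨ length-++ (tabulate firstOf) ⟩
    length (tabulate firstOf) + length (tabulate lastOf) ≡⟨ cong₂ _+_ (length-tabulate firstOf) (length-tabulate lastOf) ⟩
    k + k                                              ≡⟨ cong (k +_) (sym (+-identityʳ k)) ⟩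
    2 * k                                              ∎
    where open ≡-Reasoning

  first∈ends : ∀ j → firstOf j ∈ ends
  first∈ends j = ∈-++⁺ˡ (∈-tabulate⁺ {f = firstOf} j)

  last∈ends : ∀ j → lastOf j ∈ ends
  last∈ends j = ∈-++⁺ʳ (tabulate firstOf) (∈-tabulate⁺ {f = lastOf} j)

  ∉-ends-interior : ∀ {j x} → f x ≡ j → x ∉ ends → Interior (Block j) x
  ∉-ends-interior {j} {x} fx≡j x∉ = fx≡j ,
    (firstOf j , proj₁ (proj₂ (first j)) ,
       ≤∧≢⇒< (proj₂ (proj₂ (first j)) x fx≡j) (λ same → x∉ (subst (_∈ ends) (toℕ-injective same) (first∈ends j)))) ,
    (lastOf j , proj₁ (proj₂ (last j)) ,
       ≤∧≢⇒< (proj₂ (proj₂ (last j)) x fx≡j) (λ same → x∉ (subst (_∈ ends) (sym (toℕ-injective same)) (last∈ends j))))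

module Join {n k c} (E : List (Fin n)) (outside : Fin n → Fin k) (inside : ∀ x → x ∈ E → Fin c) where

  open DecMembership (_≟ᶠ_ {n}) using (_∈?_)

  side : Fin n → Fin k ⊎ Fin c
  side x with x ∈? E
  ... | yes x∈E = inj₂ (inside x x∈E)
  ... | no  _   = inj₁ (outside x)

  colour : Fin n → Fin (k + c)
  colour = join k c ∘ side

  side-inj₁ : ∀ {x j} → side x ≡ inj₁ j → outside x ≡ j × x ∉ E
  side-inj₁ {x} eq with x ∈? E
  side-inj₁ () | yes _
  ... | no x∉E = inj₁-injective eq , x∉E

  side-inj₂ : ∀ {x i} → side x ≡ inj₂ i → Class E inside i x
  side-inj₂ {x} eq with x ∈? E
  side-inj₂ () | no _
  ... | yes x∈E = x∈E , inj₂-injective eq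

  colour-side : ∀ {x j′} → colour x ≡ j′ → side x ≡ splitAt k j′
  colour-side {x} refl = sym (splitAt-join k c (side x))

  colour-monotone : ∀ {π : Permutation′ n} →
    (∀ j → Monotone π (λ x → outside x ≡ j × x ∉ E)) → (∀ i → Monotone π (Class E inside i)) →
    ∀ j′ → Monotone π (λ x → colour x ≡ j′)
  colour-monotone {π} outside-mono inside-mono j′ with splitAt k j′ in split
  ... | inj₁ j = Monotone-⊆ {π = π} (λ _ cx → side-inj₁ (trans (colour-side cx) split)) (outside-mono j)
  ... | inj₂ i = Monotone-⊆ {π = π} (λ _ cx → side-inj₂ (trans (colour-side cx) split)) (inside-mono i)

position-⟨$⟩ʳ : ∀ {n} (π : Permutation′ n) {p q} → toℕ p < toℕ q → position π (π ⟨$⟩ʳ p) < position π (π ⟨$⟩ʳ q)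
position-⟨$⟩ʳ π = subst₂ _<_ (sym (cong toℕ (inverseˡ π))) (sym (cong toℕ (inverseˡ π)))

Monotone⇒OccursMonotonically : ∀ {n} {π : Permutation′ n} {P : Fin n → Set} → Monotone π P → OccursMonotonically π P
Monotone⇒OccursMonotonically {π = π} (inj₁ inc) = inj₁ λ p q p<q px py → inc _ _ px py (position-⟨$⟩ʳ π p<q)
Monotone⇒OccursMonotonically {π = π} (inj₂ dec) = inj₂ λ p q p<q px py → dec _ _ px py (position-⟨$⟩ʳ π p<q)

extra-colours-bound : ∀ k c l → l ≡ 2 * k → c * c ≤ 4 * l → (k + c ∸ k) * (k + c ∸ k) ≤ 8 * k
extra-colours-bound k c l refl c²≤4l rewrite m+n∸m≡n k c | *-assoc 4 2 k = c²≤4l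

lemma5 : (n : ℕ) (π : Permutation′ n) (k : ℕ) →
    RelaxedAF (Caterpillar n id) (Caterpillar n π) k →
    Σ ℕ λ m → ((m ∸ k) * (m ∸ k) ≤ 8 * k) ×
      Σ (Fin n → Fin m) λ g → ∀ j → OccursMonotonically π (λ x → g x ≡ j)
lemma5 zero     π k _ = k , subst (λ t → t * t ≤ 8 * k) (sym (n∸n≡0 k)) z≤n , (λ ()) , λ _ → inj₁ λ ()
lemma5 (suc n₀) π k (f , onto , agreement) = assemble (monotoneColouring ends)
  where
  open BlockEnds f onto
  open MonotonePartition π using (MonotoneColouring; monotoneColouring)
  outside-monotone : ∀ j → Monotone π (λ x → f x ≡ j × x ∉ ends)
  outside-monotone j = Monotone-⊆ {π = π} (λ x (fx≡j , x∉) → ∉-ends-interior fx≡j x∉)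
                         (agreeing-block-interior-monotone π (λ x → f x ≟ᶠ j) (agreement j))
  assemble : MonotoneColouring ends → Σ ℕ λ m → ((m ∸ k) * (m ∸ k) ≤ 8 * k) ×
               Σ (Fin (suc n₀) → Fin m) λ g → ∀ j → OccursMonotonically π (λ x → g x ≡ j)
  assemble (c , c²≤ , inside , inside-monotone) =
    k + c , extra-colours-bound k c _ length-ends c²≤ , colour ,
    λ j′ → Monotone⇒OccursMonotonically {π = π} (colour-monotone {π = π} outside-monotone inside-monotone j′)
    where open Join ends f inside
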